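{- Let $F$ be a forest, and let $G$, $\beta$ and the notion of $\beta$-matching be as described in the context. Let $M$ be a $\beta$-matching. If $u$ is an $M$-unsaturated vertex of $G$ and $Q(u)$ is the set of vertices reachable from $u$ in $G$ by $M$-alternating paths of even length, then $|Q(u)|=\beta(u)$.
   Context: For a forest $F$, $\mathcal{N}(F)$ is the null space of its adjacency matrix (functions $z:V(F)\to\mathbb{R}$ with $\sum_{y\in N_F(x)}z(y)=0$ for all $x$). $S$ is the set of vertices $x$ of $F$ with $z(x)\neq 0$ for some $z\in\mathcal{N}(F)$. $G$ is the forest whose edges are the edges of $F$ having at least one endpoint in $S$ and whose vertices are the endpoints of those edges. $R=V(G)\setminus S$. Each component of $G$ is rooted at some (arbitrarily chosen) vertex of $S$; $\kappa(x)$ denotes the set of children and $\pi(x)$ the parent of $x$ (every vertex of $R$ has at least one child). Define $\overline{\beta}:V(G)\to\mathbb{N}$ recursively by $\overline{\beta}(x)=\min_{c\in\kappa(x)}\overline{\beta}(c)$ if $x\in R$ and $\overline{\beta}(x)=1+\sum_{c\in\kappa(x)}\overline{\beta}(c)$ if $x\in S$. Define $\beta:V(G)\to\mathbb{N}$ by $\beta(x)=\min\{\overline{\beta}(x),\,\beta(\pi(x))-\overline{\beta}(x)\}$ if $x\in R$ and $\beta(x)=\overline{\beta}(x)+\beta(\pi(x))$ if $x\in S$, with $\beta(\pi(x))=0$ if $x$ has no parent. For $x\in R$, a $\beta$-minimizer for $x$ is a neighbor $y$ of $x$ in $G$ such that either $y\in\kappa(x)$ and $\beta(x)=\overline{\beta}(y)$,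 or $y=\pi(x)$ and $\beta(x)=\beta(\pi(x))-\overline{\beta}(x)$. A $\beta$-matching is any set of edges $\{r\phi(r)\colon r\in R\}$ where, for each $r\in R$, $\phi(r)$ is a $\beta$-minimizer for $r$ (it is a matching of $G$). A vertex is $M$-unsaturated if it is not an endpoint of an edge of $M$. An $M$-alternating path alternates between edges in $M$ and edges not in $M$; length is the number of edges, and the zero-length path from $u$ to itself counts (so $u\in Q(u)$). -}

module Defs where

open import Data.Nat using (ℕ; zero; suc; _+_; _∸_; _⊓_; _≤_; _<_)
open import Data.Nat.Divisibility using (_∣_)
open import Data.Fin using (Fin; zero; suc) renaming (_≟_ to _≟F_)
open import Data.Bool using (Bool; true; false; if_then_else_; T)
open import Data.Rational using (ℚ; 0ℚ) renaming (_+_ to _+ℚ_)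
open import Data.List using (List; []; _∷_; length; last; _∷ʳ_)
open import Data.List.Relation.Unary.Unique.Propositional using (Unique)
open import Data.List.Relation.Unary.Linked using (Linked)
open import Data.List.Membership.Propositional using (_∈_)
open import Data.Maybe using (Maybe; just; nothing; maybe)
import Data.Maybe.Properties as MP
open import Data.Product using (Σ; ∃; _×_; _,_)
open import Data.Sum using (_⊎_)
open import Data.Unit using (⊤)
open import Function.Bundles using (_⇔_)
open import Relation.Binary.PropositionalEquality using (_≡_)
open import Relation.Nullary using (¬_; does)

Graph : ℕ → Set
Graph n = Fin n → Fin n → Bool

module _ {n : ℕ} (A : Graph n) where

  Adj : Fin n → Fin n → Set
  Adj x y = T (A x y)

  IsSimple : Set
  IsSimple = (∀ x y → A x y ≡ A y x) × (∀ x → A x x ≡ false)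

  HasCycle : Set
  HasCycle = Σ (Fin n) λ v → Σ (List (Fin n)) λ ws →
    (2 ≤ length ws) × Unique (v ∷ ws) × Linked Adj ((v ∷ ws) ∷ʳ v)

  IsForest : Set
  IsForest = IsSimple × ¬ HasCycle

sumℚ : ∀ {n} → (Fin n → ℚ) → ℚ
sumℚ {zero}  f = 0ℚ
sumℚ {suc n} f = f zero +ℚ sumℚ (λ i → f (suc i))

sumℕ : ∀ {n} → (Fin n → ℕ) → ℕ
sumℕ {zero}  f = 0
sumℕ {suc n} f = f zero + sumℕ (λ i → f (suc i))

module _ {n : ℕ} (A : Graph n) where

  InNull : (Fin n → ℚ) → Set
  InNull z = ∀ x → sumℚ (λ y → if A x y then z y else 0ℚ) ≡ 0ℚ

  InS : Fin n → Set
  InS x = Σ (Fin n → ℚ) λ z → InNull z × ¬ (z x ≡ 0ℚ)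

  GEdge : Fin n → Fin n → Set
  GEdge x y = Adj A x y × (InS x ⊎ InS y)

  InVG : Fin n → Set
  InVG x = Σ (Fin n) λ y → GEdge x y

  InR : Fin n → Set
  InR x = InVG x × ¬ InS x

  -- π is a parent function rooting every component of G at a vertex of S
  -- (nothing = no parent).
  IsRooting : (Fin n → Maybe (Fin n)) → Set
  IsRooting π =
      (∀ x p → π x ≡ just p → GEdge x p)
    × (∀ x y → GEdge x y → (π x ≡ just y) ⊎ (π y ≡ just x))
    × (∀ x → InVG x → π x ≡ nothing → InS x)
    × (Σ (Fin n → ℕ) λ depth → ∀ x p → π x ≡ just p → depth p < depth x)

  module _ (π : Fin n → Maybe (Fin n)) where

    Child : Fin n → Fin n → Set
    Child x c = π c ≡ just x

    childSum : (Fin n → ℕ) → Fin n → ℕ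
    childSum f x =
      sumℕ (λ c → if does (MP.≡-dec _≟F_ (π c) (just x)) then f c else 0)

    atParent : (Fin n → ℕ) → Fin n → ℕ
    atParent g x = maybe g 0 (π x)

    IsBetaBar : (Fin n → ℕ) → Set
    IsBetaBar b = ∀ x →
        (InS x → b x ≡ 1 + childSum b x)
      × (InR x → (Σ (Fin n) λ c → Child x c × b x ≡ b c)
                 × (∀ c → Child x c → b x ≤ b c))

    IsBeta : (Fin n → ℕ) → (Fin n → ℕ) → Set
    IsBeta b β = ∀ x →
        (InS x → β x ≡ b x + atParent β x)
      × (InR x → β x ≡ b x ⊓ (atParent β x ∸ b x))

    IsMinimizer : (Fin n → ℕ) → (Fin n → ℕ) → Fin n → Fin n → Set
    IsMinimizer b β x y = GEdge x y ×
      ((Child x y × β x ≡ b y) ⊎ (π x ≡ just y × β x ≡ β y ∸ b x))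

    -- M = { r φ(r) : r ∈ R } is a β-matching
    IsBetaMatching : (Fin n → ℕ) → (Fin n → ℕ) → (Fin n → Fin n) → Set
    IsBetaMatching b β φ = ∀ r → InR r → IsMinimizer b β r (φ r)

  module _ (φ : Fin n → Fin n) where

    InM : Fin n → Fin n → Set
    InM x y = Σ (Fin n) λ r → InR r ×
      ((x ≡ r × y ≡ φ r) ⊎ (x ≡ φ r × y ≡ r))

    Unsaturated : Fin n → Set
    Unsaturated u = InVG u × (∀ y → ¬ InM u y)

    Alternating : List (Fin n) → Set
    Alternating (a ∷ b ∷ c ∷ rest) =
      ((InM a b × ¬ InM b c) ⊎ (¬ InM a b × InM b c)) × Alternating (b ∷ c ∷ rest)
    Alternating _ = ⊤

    InQ : Fin n → Fin n → Set
    InQ u v = Σ (List (Fin n)) λ ws →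
        Unique (u ∷ ws) × Linked GEdge (u ∷ ws) × Alternating (u ∷ ws)
      × (2 ∣ length ws) × (last (u ∷ ws) ≡ just v)

HasCard : ∀ {n} → (Fin n → Set) → ℕ → Set
HasCard {n} P k = Σ (List (Fin n)) λ xs →
  Unique xs × (∀ v → (v ∈ xs) ⇔ P v) × (length xs ≡ k)

{-# OPTIONS --safe #-}

-- S is independent in F: a null vector that is nonzero at both ends of an edge can be followed
-- along a non-backtracking walk of any length, since the kernel equation at the current vertex
-- always supplies a further neighbour where it is nonzero, and in a forest such walks are paths.
-- So G is bipartite with sides S and R, every r ∈ R is matched to the neighbour φ r ∈ S, and the
-- inequalities defining β force φ to be injective on R.  An even alternating path from the
-- unsaturated u ∈ S is a sequence of moves s → φ r across non-matching edges s r.  In the rooted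
-- forest it climbs from u through parents matched upwards, possibly steps across once to a sibling
-- matched to the common parent, and then only descends through children matched downwards.  The
-- descending part from s has 1 + Σ β̄ c vertices, summing over the children c of s not matched
-- to s, which is β̄ s minus β̄ of the child matched to s; the part above a vertex with parent r
-- has β r vertices, by the recursion defining β.  Hence |Q(u)| = β̄ u + β (π u) = β u.

module Submission where

open import Defs
open import Data.Nat using (ℕ; zero; suc; _+_; _∸_; _≤_; _<_; s≤s; z≤n)
open import Data.Nat.Properties
  using (≤-refl; ≤-trans; ≤-antisym; ≤-total; <-irrefl; <-trans; ≤-<-trans; <⇒≤; <⇒≱; 1+n≰n; n≤1+n;
         m≤m+n; m≤n+m; m⊓n≤m; m≤n+m∸n; m+n∸n≡m; +-comm; +-identityʳ; +-monoˡ-≤; +-monoʳ-≤; +-mono-<;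
         ∸-monoʳ-<; +-commutativeSemigroup)
open import Data.Nat.Divisibility
  using (_∣_; _∣0; ∣-refl; ∣m∣n⇒∣m+n; ∣m+n∣m⇒∣n; ∣1⇒≡1)
open import Data.Nat.Induction using (<-wellFounded)
open import Data.Fin using (Fin; zero; suc; _≟_)
open import Data.Fin.Properties using (any?; ⊎⇔∃; injective⇒≤; suc-injective; 0≢1+n)
open import Data.Bool using (Bool; true; false; if_then_else_; T)
open import Data.Maybe using (Maybe; just; nothing)
open import Data.Maybe.Properties using (just-injective; ≡-dec)
open import Data.Rational using (ℚ; 0ℚ) renaming (_+_ to _+ℚ_)
import Data.Rational.Properties as ℚ
open import Data.List using (List; []; _∷_; _++_; _∷ʳ_; length; last; lookup)
open import Data.List.Properties using (length-++)
open import Data.List.Relation.Unary.All using (All; []; _∷_)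
import Data.List.Relation.Unary.All as All
open import Data.List.Relation.Unary.All.Properties using (¬Any⇒All¬; ++⁻ˡ)
open import Data.List.Relation.Unary.AllPairs using ([]; _∷_)
open import Data.List.Relation.Unary.Any using (here; there)
open import Data.List.Relation.Unary.Linked using (Linked; []; [-]; _∷_)
import Data.List.Relation.Unary.Linked as Linked
open import Data.List.Relation.Unary.Unique.Propositional using (Unique)
open import Data.List.Relation.Unary.Unique.Propositional.Properties using (++⁺)
open import Data.List.Relation.Binary.Disjoint.Propositional using (Disjoint)
open import Data.List.Membership.Propositional using (_∈_; _∉_)
open import Data.List.Membership.Propositional.Properties
  using (∈-∃++; ++-∈⇔; ∈-lookup; ∈-insert)
open import Data.Product using (Σ; ∃; _×_; _,_; proj₁; proj₂)
open import Data.Sum using (_⊎_; inj₁; inj₂)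
import Data.Sum as Sum
open import Data.Unit using (⊤; tt)
open import Data.Empty using (⊥; ⊥-elim)
open import Function using (_∘_)
open import Function.Bundles using (_⇔_; mk⇔; Equivalence)
open import Function.Properties.Equivalence using () renaming (trans to ⇔-trans; sym to ⇔-sym)
open import Algebra.Bundles using (CommutativeMonoid)
import Algebra.Properties.CommutativeSemigroup as CommSemigroupProperties
open import Induction.WellFounded using (WellFounded; Acc; acc; module Subrelation)
import Relation.Binary.Construct.On as On
open import Relation.Binary.Construct.Closure.ReflexiveTransitive using (Star; ε; _◅_)
open import Relation.Binary.PropositionalEquality
  using (_≡_; _≢_; refl; sym; trans; cong; cong₂; subst; module ≡-Reasoning)
open import Relation.Nullary using (¬_; Dec; yes; no; does)
open import Relation.Nullary.Decidable using (¬?; _×-dec_; T?)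

open Equivalence using (to; from)
open CommSemigroupProperties +-commutativeSemigroup using (interchange; xy∙z≈xz∙y)
open CommSemigroupProperties (CommutativeMonoid.commutativeSemigroup ℚ.+-0-commutativeMonoid)
  using () renaming (interchange to interchangeℚ)

if-true : ∀ {A : Set} {b : Bool} {x y : A} → T b → (if b then x else y) ≡ x
if-true {b = true} _ = refl

if-yes : ∀ {P : Set} (d : Dec P) {a b : ℕ} → P → (if does d then a else b) ≡ a
if-yes (yes _) _ = refl
if-yes (no ¬p) p = ⊥-elim (¬p p)

if-cong : ∀ {P : Set} (d : Dec P) {a b : ℕ} → (P → a ≡ b) →
          (if does d then a else 0) ≡ (if does d then b else 0)
if-cong (yes p) a≡b = a≡b p
if-cong (no _)  _   = refl

if-zero : ∀ {P : Set} (d : Dec P) {a : ℕ} → (P → a ≡ 0) → (if does d then a else 0) ≡ 0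
if-zero (yes p) a≡0 = a≡0 p
if-zero (no _)  _   = refl

if-+ : ∀ {P : Set} (d : Dec P) {a b : ℕ} →
       (if does d then a + b else 0) ≡ (if does d then a else 0) + (if does d then b else 0)
if-+ (yes _) = refl
if-+ (no _)  = refl

sumℕ-cong : ∀ {n} {f g : Fin n → ℕ} → (∀ i → f i ≡ g i) → sumℕ f ≡ sumℕ g
sumℕ-cong {zero}  f≗g = refl
sumℕ-cong {suc n} f≗g = cong₂ _+_ (f≗g zero) (sumℕ-cong (f≗g ∘ suc))

sumℕ-+ : ∀ {n} (f g : Fin n → ℕ) → sumℕ (λ i → f i + g i) ≡ sumℕ f + sumℕ g
sumℕ-+ {zero}  f g = refl
sumℕ-+ {suc n} f g =
  trans (cong (f zero + g zero +_) (sumℕ-+ (f ∘ suc) (g ∘ suc))) (interchange (f zero) (g zero) _ _)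

sumℕ-zero : ∀ {n} (f : Fin n → ℕ) → (∀ i → f i ≡ 0) → sumℕ f ≡ 0
sumℕ-zero {zero}  f f≗0 = refl
sumℕ-zero {suc n} f f≗0 = cong₂ _+_ (f≗0 zero) (sumℕ-zero (f ∘ suc) (f≗0 ∘ suc))

sumℕ-single : ∀ {n} (f : Fin n → ℕ) i → (∀ j → j ≢ i → f j ≡ 0) → sumℕ f ≡ f i
sumℕ-single f zero    others =
  trans (cong (f zero +_) (sumℕ-zero (f ∘ suc) (λ j → others (suc j) (λ ())))) (+-identityʳ (f zero))
sumℕ-single f (suc i) others =
  cong₂ _+_ (others zero (λ ()))
            (sumℕ-single (f ∘ suc) i (λ j j≢i → others (suc j) (j≢i ∘ suc-injective)))

sumℕ-term : ∀ {n} (f : Fin n → ℕ) i → f i ≤ sumℕ f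
sumℕ-term f zero    = m≤m+n (f zero) _
sumℕ-term f (suc i) = ≤-trans (sumℕ-term (f ∘ suc) i) (m≤n+m _ (f zero))

sumℕ-two : ∀ {n} (f : Fin n → ℕ) {i j} → i ≢ j → f i + f j ≤ sumℕ f
sumℕ-two f {zero}  {zero}  i≢j = ⊥-elim (i≢j refl)
sumℕ-two f {zero}  {suc j} _   = +-monoʳ-≤ (f zero) (sumℕ-term (f ∘ suc) j)
sumℕ-two f {suc i} {zero}  _   =
  subst (_≤ sumℕ f) (+-comm (f zero) _) (+-monoʳ-≤ (f zero) (sumℕ-term (f ∘ suc) i))
sumℕ-two f {suc i} {suc j} i≢j = ≤-trans (sumℕ-two (f ∘ suc) (i≢j ∘ cong suc)) (m≤n+m _ (f zero))

m≤n+n⇒m≤o+o⇒m≤n+o : ∀ {m} n o → m ≤ n + n → m ≤ o + o → m ≤ n + o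
m≤n+n⇒m≤o+o⇒m≤n+o n o m≤2n m≤2o with ≤-total n o
... | inj₁ n≤o = ≤-trans m≤2n (+-monoʳ-≤ n n≤o)
... | inj₂ o≤n = ≤-trans m≤2o (+-monoˡ-≤ o o≤n)

sumℚ-cong : ∀ {n} {f g : Fin n → ℚ} → (∀ i → f i ≡ g i) → sumℚ f ≡ sumℚ g
sumℚ-cong {zero}  f≗g = refl
sumℚ-cong {suc n} f≗g = cong₂ _+ℚ_ (f≗g zero) (sumℚ-cong (f≗g ∘ suc))

sumℚ-+ : ∀ {n} (f g : Fin n → ℚ) → sumℚ (λ i → f i +ℚ g i) ≡ sumℚ f +ℚ sumℚ g
sumℚ-+ {zero}  f g = sym (ℚ.+-identityʳ 0ℚ)
sumℚ-+ {suc n} f g =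
  trans (cong (f zero +ℚ g zero +ℚ_) (sumℚ-+ (f ∘ suc) (g ∘ suc)))
        (interchangeℚ (f zero) (g zero) _ _)

sumℚ-zero : ∀ {n} (f : Fin n → ℚ) → (∀ i → f i ≡ 0ℚ) → sumℚ f ≡ 0ℚ
sumℚ-zero {zero}  f f≗0 = refl
sumℚ-zero {suc n} f f≗0 =
  trans (cong₂ _+ℚ_ (f≗0 zero) (sumℚ-zero (f ∘ suc) (f≗0 ∘ suc))) (ℚ.+-identityʳ 0ℚ)

sumℚ-single : ∀ {n} (f : Fin n → ℚ) i → (∀ j → j ≢ i → f j ≡ 0ℚ) → sumℚ f ≡ f i
sumℚ-single f zero    others =
  trans (cong (f zero +ℚ_) (sumℚ-zero (f ∘ suc) (λ j → others (suc j) (λ ()))))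
        (ℚ.+-identityʳ (f zero))
sumℚ-single f (suc i) others =
  trans (cong₂ _+ℚ_ (others zero (λ ()))
                    (sumℚ-single (f ∘ suc) i (λ j j≢i → others (suc j) (j≢i ∘ suc-injective))))
        (ℚ.+-identityˡ (f (suc i)))

module _ {n : ℕ} where

  HasCard-cong : ∀ {P Q : Fin n → Set} {k} → (∀ v → P v ⇔ Q v) → HasCard P k → HasCard Q k
  HasCard-cong P⇔Q (xs , xs! , ∈⇔P , |xs|) =
    xs , xs! , (λ v → ⇔-trans (∈⇔P v) (P⇔Q v)) , |xs|

  HasCard-∅ : ∀ {P : Fin n → Set} → (∀ v → ¬ P v) → HasCard P 0
  HasCard-∅ ¬P = [] , [] , (λ v → mk⇔ (λ ()) (⊥-elim ∘ ¬P v)) , refl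

  HasCard-≡ : (a : Fin n) → HasCard (_≡ a) 1
  HasCard-≡ a =
    a ∷ [] , [] ∷ [] , (λ v → mk⇔ (λ { (here v≡a) → v≡a ; (there ()) }) here) , refl

  HasCard-⊎ : ∀ {P Q : Fin n → Set} {k l} → (∀ {v} → P v → Q v → ⊥) →
              HasCard P k → HasCard Q l → HasCard (λ v → P v ⊎ Q v) (k + l)
  HasCard-⊎ {P} {Q} P∩Q≡∅ (xs , xs! , ∈xs⇔P , |xs|) (ys , ys! , ∈ys⇔Q , |ys|) =
    xs ++ ys , ++⁺ xs! ys! disjoint , ∈⇔P⊎Q , trans (length-++ xs) (cong₂ _+_ |xs| |ys|)
    where
    disjoint : Disjoint xs ys
    disjoint (v∈xs , v∈ys) = P∩Q≡∅ (to (∈xs⇔P _) v∈xs) (to (∈ys⇔Q _) v∈ys)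
    ∈⇔P⊎Q : ∀ v → v ∈ xs ++ ys ⇔ (P v ⊎ Q v)
    ∈⇔P⊎Q v = ⇔-trans ++-∈⇔ (mk⇔ (Sum.map (to (∈xs⇔P v)) (to (∈ys⇔Q v)))
                                  (Sum.map (from (∈xs⇔P v)) (from (∈ys⇔Q v))))

  HasCard-∃ : ∀ {m} {P : Fin m → Fin n → Set} {k : Fin m → ℕ} →
              (∀ {i j v} → P i v → P j v → i ≡ j) → (∀ i → HasCard (P i) (k i)) →
              HasCard (λ v → ∃ λ i → P i v) (sumℕ k)
  HasCard-∃ {zero}  _      _    = HasCard-∅ (λ { v (() , _) })
  HasCard-∃ {suc m} unique card =
    HasCard-cong (λ v → ⊎⇔∃)
      (HasCard-⊎ (λ p (i , q) → 0≢1+n (unique p q))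
                 (card zero)
                 (HasCard-∃ (λ p q → suc-injective (unique p q)) (card ∘ suc)))

module _ {A : Set} where

  NonBacktracking : List A → Set
  NonBacktracking (x ∷ xs@(_ ∷ z ∷ _)) = x ≢ z × NonBacktracking xs
  NonBacktracking _                    = ⊤

  NonBacktracking-tail : ∀ {x xs} → NonBacktracking (x ∷ xs) → NonBacktracking xs
  NonBacktracking-tail {xs = []}        _        = tt
  NonBacktracking-tail {xs = _ ∷ []}    _        = tt
  NonBacktracking-tail {xs = _ ∷ _ ∷ _} (_ , nb) = nb

  Linked-prefix : ∀ {R : A → A → Set} xs {y ys} → Linked R (xs ++ y ∷ ys) → Linked R (xs ∷ʳ y)
  Linked-prefix []           _        = [-]
  Linked-prefix (_ ∷ [])     (r ∷ _)  = r ∷ [-]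
  Linked-prefix (_ ∷ x ∷ xs) (r ∷ rs) = r ∷ Linked-prefix (x ∷ xs) rs

  Unique-rotate : ∀ (xs : List A) {y ys} → Unique (xs ++ y ∷ ys) → Unique (y ∷ xs)
  Unique-rotate []       _              = [] ∷ []
  Unique-rotate (x ∷ xs) (x∉ ∷ unique) with Unique-rotate xs unique
  ... | y∉xs ∷ xs! = (All.lookup x∉ (∈-insert xs) ∘ sym ∷ y∉xs) ∷ ++⁻ˡ xs x∉ ∷ xs!

  lookup-injective : ∀ {xs : List A} → Unique xs → ∀ i j → lookup xs i ≡ lookup xs j → i ≡ j
  lookup-injective (x∉ ∷ _)  zero    zero    _  = refl
  lookup-injective (x∉ ∷ _)  zero    (suc j) eq = ⊥-elim (All.lookup x∉ (∈-lookup j) eq)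
  lookup-injective (x∉ ∷ _)  (suc i) zero    eq = ⊥-elim (All.lookup x∉ (∈-lookup i) (sym eq))
  lookup-injective (_ ∷ xs!) (suc i) (suc j) eq = cong suc (lookup-injective xs! i j eq)

Unique⇒length≤ : ∀ {n} {xs : List (Fin n)} → Unique xs → length xs ≤ n
Unique⇒length≤ xs! = injective⇒≤ (lookup-injective xs! _ _)

module Forest {n} {F : Graph n} (forest : IsForest F) where

  Adj-sym : ∀ {x y} → Adj F x y → Adj F y x
  Adj-sym {x} {y} = subst T (proj₁ (proj₁ forest) x y)

  Adj-irrefl : ∀ {x} → ¬ Adj F x x
  Adj-irrefl {x} xx = subst T (proj₂ (proj₁ forest) x) xx

  nonBacktracking⇒Unique : ∀ {xs} → Linked (Adj F) xs → NonBacktracking xs → Unique xs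
  nonBacktracking⇒Unique []  _ = []
  nonBacktracking⇒Unique [-] _ = [] ∷ []
  nonBacktracking⇒Unique {x ∷ ys} walk@(_ ∷ rest) nb = ¬Any⇒All¬ ys x∉ys ∷ ys!
    where
    ys! : Unique ys
    ys! = nonBacktracking⇒Unique rest (NonBacktracking-tail nb)
    closes-cycle : ∀ pre {post} → ys ≡ pre ++ x ∷ post → ⊥
    closes-cycle [] refl with walk
    ... | xx ∷ _ = Adj-irrefl xx
    closes-cycle (_ ∷ []) refl = proj₁ nb refl
    closes-cycle pre@(_ ∷ _ ∷ _) refl =
      proj₂ forest (x , pre , s≤s (s≤s z≤n) , Unique-rotate pre ys! , Linked-prefix (x ∷ pre) walk)
    x∉ys : x ∉ ys
    x∉ys x∈ys with ∈-∃++ x∈ys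
    ... | pre , post , ys≡ = closes-cycle pre ys≡

module NullSpace {n} {F : Graph n} (forest : IsForest F) where

  open Forest forest

  InNull-+ : ∀ {z₁ z₂} → InNull F z₁ → InNull F z₂ → InNull F (λ y → z₁ y +ℚ z₂ y)
  InNull-+ {z₁} {z₂} null₁ null₂ x = begin
    sumℚ (λ y → if F x y then z₁ y +ℚ z₂ y else 0ℚ) ≡⟨ sumℚ-cong (λ y → distrib (F x y)) ⟩
    sumℚ (λ y → row z₁ y +ℚ row z₂ y)              ≡⟨ sumℚ-+ (row z₁) (row z₂) ⟩
    sumℚ (row z₁) +ℚ sumℚ (row z₂)                 ≡⟨ cong₂ _+ℚ_ (null₁ x) (null₂ x) ⟩
    0ℚ +ℚ 0ℚ                                       ≡⟨ ℚ.+-identityʳ 0ℚ ⟩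
    0ℚ                                             ∎
    where
    open ≡-Reasoning
    row : (Fin n → ℚ) → Fin n → ℚ
    row z y = if F x y then z y else 0ℚ
    distrib : ∀ b {p q} → (if b then p +ℚ q else 0ℚ) ≡ (if b then p else 0ℚ) +ℚ (if b then q else 0ℚ)
    distrib true  = refl
    distrib false = sym (ℚ.+-identityʳ 0ℚ)

  nonzero-at-both : ∀ {x y} → InS F x → InS F y →
                    Σ (Fin n → ℚ) λ z → InNull F z × z x ≢ 0ℚ × z y ≢ 0ℚ
  nonzero-at-both {x} {y} (z₁ , null₁ , z₁x≢0) (z₂ , null₂ , z₂y≢0)
    with z₁ y ℚ.≟ 0ℚ | z₂ x ℚ.≟ 0ℚ
  ... | no z₁y≢0 | _        = z₁ , null₁ , z₁x≢0 , z₁y≢0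
  ... | yes _    | no z₂x≢0 = z₂ , null₂ , z₂x≢0 , z₂y≢0
  ... | yes z₁y≡0 | yes z₂x≡0 =
    (λ v → z₁ v +ℚ z₂ v) , InNull-+ null₁ null₂ ,
    (λ sum≡0 → z₁x≢0 (trans (sym (ℚ.+-identityʳ (z₁ x)))
                            (trans (cong (z₁ x +ℚ_) (sym z₂x≡0)) sum≡0))) ,
    (λ sum≡0 → z₂y≢0 (trans (sym (ℚ.+-identityˡ (z₂ y)))
                            (trans (cong (_+ℚ z₂ y) (sym z₁y≡0)) sum≡0)))

  another-nonzero-neighbour : ∀ {z x y} → InNull F z → Adj F x y → z y ≢ 0ℚ →
                              ∃ λ w → w ≢ y × Adj F x w × z w ≢ 0ℚ
  another-nonzero-neighbour {z} {x} {y} null xy zy≢0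
    with any? (λ w → ¬? (w ≟ y) ×-dec T? (F x w) ×-dec ¬? (z w ℚ.≟ 0ℚ))
  ... | yes found = found
  ... | no none   = ⊥-elim (zy≢0 (begin
    z y                                        ≡⟨ if-true xy ⟨
    (if F x y then z y else 0ℚ)                ≡⟨ sumℚ-single _ y others-vanish ⟨
    sumℚ (λ w → if F x w then z w else 0ℚ)     ≡⟨ null x ⟩
    0ℚ                                         ∎))
    where
    open ≡-Reasoning
    others-vanish : ∀ w → w ≢ y → (if F x w then z w else 0ℚ) ≡ 0ℚ
    others-vanish w w≢y with F x w in xw | z w ℚ.≟ 0ℚ
    ... | false | _         = refl
    ... | true  | yes zw≡0  = zw≡0
    ... | true  | no zw≢0   = ⊥-elim (none (w , w≢y , subst T (sym xw) tt , zw≢0))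

  nonzero-walk : ∀ {z} → InNull F z → ∀ k {x y} → Adj F x y → z x ≢ 0ℚ → z y ≢ 0ℚ →
                 Σ (List (Fin n)) λ ts →
                   Linked (Adj F) (x ∷ y ∷ ts) × NonBacktracking (x ∷ y ∷ ts) × length ts ≡ k
  nonzero-walk null zero    xy _     _     = [] , xy ∷ [-] , tt , refl
  nonzero-walk null (suc k) xy zx≢0 zy≢0 with another-nonzero-neighbour null (Adj-sym xy) zx≢0
  ... | w , w≢x , yw , zw≢0 with nonzero-walk null k yw zy≢0 zw≢0
  ...   | ts , walk , nb , |ts| = w ∷ ts , xy ∷ walk , (w≢x ∘ sym , nb) , cong suc |ts|

  S-independent : ∀ {x y} → InS F x → InS F y → ¬ Adj F x y
  S-independent x∈S y∈S xy with nonzero-at-both x∈S y∈S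
  ... | z , null , zx≢0 , zy≢0 with nonzero-walk null n xy zx≢0 zy≢0
  ...   | ts , walk , nb , |ts|≡n =
    1+n≰n (≤-trans (n≤1+n _)
                   (subst (λ k → 2 + k ≤ n) |ts|≡n (Unique⇒length≤ (nonBacktracking⇒Unique walk nb))))

  GEdge-sym : ∀ {x y} → GEdge F x y → GEdge F y x
  GEdge-sym (xy , x∈S⊎y∈S) = Adj-sym xy , Sum.swap x∈S⊎y∈S

  S-neighbour-R : ∀ {x y} → InS F x → GEdge F x y → InR F y
  S-neighbour-R x∈S xy = (_ , GEdge-sym xy) , λ y∈S → S-independent x∈S y∈S (proj₁ xy)

  R-neighbour-S : ∀ {x y} → InR F x → GEdge F x y → InS F y
  R-neighbour-S (_ , x∉S) (_ , inj₁ x∈S) = ⊥-elim (x∉S x∈S)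
  R-neighbour-S _         (_ , inj₂ y∈S) = y∈S

  VG-S⊎R : ∀ {x} → InVG F x → InS F x ⊎ InR F x
  VG-S⊎R (_ , _ , inj₁ x∈S)   = inj₁ x∈S
  VG-S⊎R (_ , xy@(_ , inj₂ y∈S)) = inj₂ (S-neighbour-R y∈S (GEdge-sym xy))

module Rooting {n} {F : Graph n} {π : Fin n → Maybe (Fin n)} (rooting : IsRooting F π) where

  parent-edge : ∀ {x p} → π x ≡ just p → GEdge F x p
  parent-edge = proj₁ rooting _ _

  edge-parent : ∀ {x y} → GEdge F x y → π x ≡ just y ⊎ π y ≡ just x
  edge-parent = proj₁ (proj₂ rooting) _ _

  depth : Fin n → ℕ
  depth = proj₁ (proj₂ (proj₂ (proj₂ rooting)))

  depth-parent : ∀ {x p} → π x ≡ just p → depth p < depth x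
  depth-parent = proj₂ (proj₂ (proj₂ (proj₂ rooting))) _ _

  parent-unique : ∀ {x p q} → π x ≡ just p → π x ≡ just q → p ≡ q
  parent-unique x→p x→q = just-injective (trans (sym x→p) x→q)

  parent-asym : ∀ {x y} → π x ≡ just y → π y ≡ just x → ⊥
  parent-asym x→y y→x = <-irrefl refl (<-trans (depth-parent x→y) (depth-parent y→x))

  Shallower Deeper : Fin n → Fin n → Set
  Shallower x y = depth x < depth y
  Deeper    x y = depth y < depth x

  shallower-wellFounded : WellFounded Shallower
  shallower-wellFounded = On.wellFounded depth <-wellFounded

  deeper-wellFounded : WellFounded Deeper
  deeper-wellFounded =
    Subrelation.wellFounded (λ {x} y<x → ∸-monoʳ-< y<x (sumℕ-term depth x))
                            (On.wellFounded height <-wellFounded)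
    where
    height : Fin n → ℕ
    height x = sumℕ depth ∸ depth x

  infix 4 _≼_
  data _≼_ (x : Fin n) : Fin n → Set where
    ≼-refl : x ≼ x
    ≼-step : ∀ {v p} → π v ≡ just p → x ≼ p → x ≼ v

  ≼-depth : ∀ {x v} → x ≼ v → depth x ≤ depth v
  ≼-depth ≼-refl           = ≤-refl
  ≼-depth (≼-step v→p x≼p) = ≤-trans (≼-depth x≼p) (<⇒≤ (depth-parent v→p))

  ≼-parent : ∀ {x p v} → x ≼ v → π x ≡ just p → p ≼ v
  ≼-parent ≼-refl           x→p = ≼-step x→p ≼-refl
  ≼-parent (≼-step v→q x≼q) x→p = ≼-step v→q (≼-parent x≼q x→p)

  ≼-total : ∀ {x y v} → x ≼ v → y ≼ v → x ≼ y ⊎ y ≼ x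
  ≼-total ≼-refl           y≼v              = inj₂ y≼v
  ≼-total x≼v@(≼-step _ _) ≼-refl           = inj₁ x≼v
  ≼-total (≼-step v→p x≼p) (≼-step v→q y≼q) with parent-unique v→p v→q
  ... | refl = ≼-total x≼p y≼q

  ≼-same-parent : ∀ {x y p} → x ≼ y → π x ≡ just p → π y ≡ just p → x ≡ y
  ≼-same-parent ≼-refl           _   _   = refl
  ≼-same-parent (≼-step y→q x≼q) x→p y→p with parent-unique y→q y→p
  ... | refl = ⊥-elim (<⇒≱ (depth-parent x→p) (≼-depth x≼q))

  ≼-sibling : ∀ {x y p v} → π x ≡ just p → π y ≡ just p → x ≼ v → y ≼ v → x ≡ y
  ≼-sibling x→p y→p x≼v y≼v with ≼-total x≼v y≼v
  ... | inj₁ x≼y = ≼-same-parent x≼y x→p y→p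
  ... | inj₂ y≼x = sym (≼-same-parent y≼x y→p x→p)

module ChildSum {n} (F : Graph n) (π : Fin n → Maybe (Fin n)) where

  child? : ∀ x c → Dec (π c ≡ just x)
  child? x c = ≡-dec _≟_ (π c) (just x)

  childSum-cong : ∀ {f g x} → (∀ c → π c ≡ just x → f c ≡ g c) →
                  childSum F π f x ≡ childSum F π g x
  childSum-cong {x = x} f≗g = sumℕ-cong (λ c → if-cong (child? x c) (f≗g c))

  childSum-+ : ∀ f g x → childSum F π (λ c → f c + g c) x ≡ childSum F π f x + childSum F π g x
  childSum-+ f g x =
    trans (sumℕ-cong (λ c → if-+ (child? x c))) (sumℕ-+ (λ c → if does (child? x c) then f c else 0) _)

  childSum-zero : ∀ {f x} → (∀ c → π c ≡ just x → f c ≡ 0) → childSum F π f x ≡ 0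
  childSum-zero {x = x} f≗0 = sumℕ-zero _ (λ c → if-zero (child? x c) (f≗0 c))

  childSum-single : ∀ {f x c₀} → π c₀ ≡ just x → (∀ c → π c ≡ just x → c ≢ c₀ → f c ≡ 0) →
                    childSum F π f x ≡ f c₀
  childSum-single {x = x} {c₀} c₀→x others =
    trans (sumℕ-single _ c₀ (λ c c≢c₀ → if-zero (child? x c) (λ c→x → others c c→x c≢c₀)))
          (if-yes (child? x c₀) c₀→x)

  childSum-term : ∀ f {x c} → π c ≡ just x → f c ≤ childSum F π f x
  childSum-term f {x} {c} c→x = subst (_≤ childSum F π f x) (if-yes (child? x c) c→x) (sumℕ-term _ c)

  childSum-two : ∀ f {x c₁ c₂} → c₁ ≢ c₂ → π c₁ ≡ just x → π c₂ ≡ just x →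
                 f c₁ + f c₂ ≤ childSum F π f x
  childSum-two f {x} {c₁} {c₂} c₁≢c₂ c₁→x c₂→x =
    subst (_≤ childSum F π f x) (cong₂ _+_ (if-yes (child? x c₁) c₁→x) (if-yes (child? x c₂) c₂→x))
          (sumℕ-two _ c₁≢c₂)

module BetaMatching
  {n} {F : Graph n} (forest : IsForest F)
  {π : Fin n → Maybe (Fin n)} (rooting : IsRooting F π)
  (βbar β : Fin n → ℕ) (isβbar : IsBetaBar F π βbar) (isβ : IsBeta F π βbar β)
  (φ : Fin n → Fin n) (matching : IsBetaMatching F π βbar β φ)
  where

  open NullSpace forest
  open Rooting rooting
  open ChildSum F π

  parent-of-S : ∀ {s r} → InS F s → π s ≡ just r → InR F r
  parent-of-S s∈S s→r = S-neighbour-R s∈S (parent-edge s→r)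

  child-of-S : ∀ {s r} → InS F s → π r ≡ just s → InR F r
  child-of-S s∈S r→s = S-neighbour-R s∈S (GEdge-sym (parent-edge r→s))

  φ-S : ∀ {r} → InR F r → InS F (φ r)
  φ-S r∈R = R-neighbour-S r∈R (proj₁ (matching _ r∈R))

  φ-side : ∀ {r} → InR F r → π (φ r) ≡ just r ⊎ π r ≡ just (φ r)
  φ-side r∈R = Sum.map proj₁ proj₁ (proj₂ (matching _ r∈R))

  β-matchedDown : ∀ {r} → InR F r → π (φ r) ≡ just r → β r ≡ βbar (φ r)
  β-matchedDown r∈R r↓ with proj₂ (matching _ r∈R)
  ... | inj₁ (_ , βr≡) = βr≡
  ... | inj₂ (r↑ , _)  = ⊥-elim (parent-asym r↑ r↓)

  β-matchedUp : ∀ {r} → InR F r → π r ≡ just (φ r) → β r ≡ β (φ r) ∸ βbar r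
  β-matchedUp r∈R r↑ with proj₂ (matching _ r∈R)
  ... | inj₁ (r↓ , _)  = ⊥-elim (parent-asym r↑ r↓)
  ... | inj₂ (_ , βr≡) = βr≡

  βbar-S : ∀ {s} → InS F s → βbar s ≡ suc (childSum F π βbar s)
  βbar-S s∈S = proj₁ (isβbar _) s∈S

  β-S : ∀ {s} → InS F s → β s ≡ βbar s + atParent F π β s
  β-S s∈S = proj₁ (isβ _) s∈S

  atParent-just : ∀ {x p} → π x ≡ just p → atParent F π β x ≡ β p
  atParent-just x→p rewrite x→p = refl

  β≤βbar : ∀ {r} → InR F r → β r ≤ βbar r
  β≤βbar r∈R = subst (_≤ βbar _) (sym (proj₂ (isβ _) r∈R)) (m⊓n≤m _ _)

  βbar-R≤child : ∀ {r c} → InR F r → π c ≡ just r → βbar r ≤ βbar c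
  βbar-R≤child r∈R c→r = proj₂ (proj₂ (isβbar _) r∈R) _ c→r

  βbar-child< : ∀ {s c} → InS F s → π c ≡ just s → βbar c < βbar s
  βbar-child< s∈S c→s = subst (βbar _ <_) (sym (βbar-S s∈S)) (s≤s (childSum-term βbar c→s))

  βbar-children< : ∀ {s c₁ c₂} → InS F s → c₁ ≢ c₂ → π c₁ ≡ just s → π c₂ ≡ just s →
                   βbar c₁ + βbar c₂ < βbar s
  βbar-children< {c₁ = c₁} {c₂} s∈S c₁≢c₂ c₁→s c₂→s =
    subst (βbar c₁ + βbar c₂ <_) (sym (βbar-S s∈S)) (s≤s (childSum-two βbar c₁≢c₂ c₁→s c₂→s))

  β-matchedUp≤ : ∀ {r} → InR F r → π r ≡ just (φ r) → β (φ r) ≤ βbar r + βbar r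
  β-matchedUp≤ {r} r∈R r↑ =
    ≤-trans (m≤n+m∸n (β (φ r)) (βbar r))
            (+-monoʳ-≤ (βbar r) (subst (_≤ βbar r) (β-matchedUp r∈R r↑) (β≤βbar r∈R)))

  matchedDown-matchedUp-disjoint : ∀ {r₁ r₂} → InR F r₁ → InR F r₂ →
                                   π (φ r₁) ≡ just r₁ → π r₂ ≡ just (φ r₂) → φ r₁ ≢ φ r₂
  matchedDown-matchedUp-disjoint {r₁} {r₂} r₁∈R r₂∈R r₁↓ r₂↑ same = <⇒≱ 2βbar[r₂]<β[s] β[s]≤2βbar[r₂]
    where
    s∈S : InS F (φ r₁)
    s∈S = φ-S r₁∈R
    r₂→s : π r₂ ≡ just (φ r₁)
    r₂→s = trans r₂↑ (cong just (sym same))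
    β[s]≡ : β (φ r₁) ≡ βbar (φ r₁) + βbar (φ r₁)
    β[s]≡ = trans (β-S s∈S) (cong (βbar (φ r₁) +_) (trans (atParent-just r₁↓) (β-matchedDown r₁∈R r₁↓)))
    2βbar[r₂]<β[s] : βbar r₂ + βbar r₂ < β (φ r₁)
    2βbar[r₂]<β[s] = subst (βbar r₂ + βbar r₂ <_) (sym β[s]≡)
                           (+-mono-< (βbar-child< s∈S r₂→s) (βbar-child< s∈S r₂→s))
    β[s]≤2βbar[r₂] : β (φ r₁) ≤ βbar r₂ + βbar r₂
    β[s]≤2βbar[r₂] = subst (λ s → β s ≤ βbar r₂ + βbar r₂) (sym same) (β-matchedUp≤ r₂∈R r₂↑)

  matchedUp-unique : ∀ {r₁ r₂} → InR F r₁ → InR F r₂ →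
                     π r₁ ≡ just (φ r₁) → π r₂ ≡ just (φ r₂) → φ r₁ ≡ φ r₂ → r₁ ≡ r₂
  matchedUp-unique {r₁} {r₂} r₁∈R r₂∈R r₁↑ r₂↑ same with r₁ ≟ r₂
  ... | yes r₁≡r₂ = r₁≡r₂
  ... | no r₁≢r₂  =
    ⊥-elim (<⇒≱ (≤-<-trans β[s]≤ (βbar-children< s∈S r₁≢r₂ r₁↑ r₂→s)) βbar[s]≤β[s])
    where
    s∈S : InS F (φ r₁)
    s∈S = φ-S r₁∈R
    r₂→s : π r₂ ≡ just (φ r₁)
    r₂→s = trans r₂↑ (cong just (sym same))
    β[s]≤ : β (φ r₁) ≤ βbar r₁ + βbar r₂
    β[s]≤ = m≤n+n⇒m≤o+o⇒m≤n+o (βbar r₁) (βbar r₂) (β-matchedUp≤ r₁∈R r₁↑)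
              (subst (λ s → β s ≤ βbar r₂ + βbar r₂) (sym same) (β-matchedUp≤ r₂∈R r₂↑))
    βbar[s]≤β[s] : βbar (φ r₁) ≤ β (φ r₁)
    βbar[s]≤β[s] = subst (βbar (φ r₁) ≤_) (sym (β-S s∈S)) (m≤m+n _ _)

  φ-injective : ∀ {r₁ r₂} → InR F r₁ → InR F r₂ → φ r₁ ≡ φ r₂ → r₁ ≡ r₂
  φ-injective r₁∈R r₂∈R same with φ-side r₁∈R | φ-side r₂∈R
  ... | inj₁ r₁↓ | inj₁ r₂↓ = just-injective (trans (sym r₁↓) (trans (cong π same) r₂↓))
  ... | inj₁ r₁↓ | inj₂ r₂↑ = ⊥-elim (matchedDown-matchedUp-disjoint r₁∈R r₂∈R r₁↓ r₂↑ same)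
  ... | inj₂ r₁↑ | inj₁ r₂↓ = ⊥-elim (matchedDown-matchedUp-disjoint r₂∈R r₁∈R r₂↓ r₁↑ (sym same))
  ... | inj₂ r₁↑ | inj₂ r₂↑ = matchedUp-unique r₁∈R r₂∈R r₁↑ r₂↑ same

  downCount matchedChildSum : Fin n → ℕ
  downCount       s = suc (childSum F π (λ c → if does (φ c ≟ s) then 0 else βbar c) s)
  matchedChildSum s = childSum F π (λ c → if does (φ c ≟ s) then βbar c else 0) s

  βbar-split : ∀ {s} → InS F s → βbar s ≡ downCount s + matchedChildSum s
  βbar-split {s} s∈S =
    trans (βbar-S s∈S) (cong suc (trans (childSum-cong (λ c _ → split c)) (childSum-+ _ _ s)))
    where
    split : ∀ c → βbar c ≡ (if does (φ c ≟ s) then 0 else βbar c) + (if does (φ c ≟ s) then βbar c else 0)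
    split c with φ c ≟ s
    ... | yes _ = refl
    ... | no _  = sym (+-identityʳ (βbar c))

  matchedChildSum-none : ∀ {s} → (∀ c → π c ≡ just s → φ c ≢ s) → matchedChildSum s ≡ 0
  matchedChildSum-none {s} unmatched =
    childSum-zero (λ c c→s → if-zero (φ c ≟ s) (⊥-elim ∘ unmatched c c→s))

  matchedChildSum-single : ∀ {r s} → InR F r → π r ≡ just s → φ r ≡ s → matchedChildSum s ≡ βbar r
  matchedChildSum-single {r} {s} r∈R r→s φr≡s =
    trans (childSum-single r→s others) (if-yes (φ r ≟ s) φr≡s)
    where
    others : ∀ c → π c ≡ just s → c ≢ r → (if does (φ c ≟ s) then βbar c else 0) ≡ 0
    others c c→s c≢r = if-zero (φ c ≟ s) λ φc≡s → ⊥-elim (c≢r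
      (φ-injective (child-of-S (subst (InS F) φr≡s (φ-S r∈R)) c→s) r∈R (trans φc≡s (sym φr≡s))))

  β-minus-matched : ∀ {s} → InS F s → β s ∸ matchedChildSum s ≡ downCount s + atParent F π β s
  β-minus-matched {s} s∈S = begin
    β s ∸ m              ≡⟨ cong (_∸ m) (trans (β-S s∈S) (cong (_+ p) (βbar-split s∈S))) ⟩
    d + m + p ∸ m        ≡⟨ cong (_∸ m) (xy∙z≈xz∙y d m p) ⟩
    d + p + m ∸ m        ≡⟨ m+n∸n≡m (d + p) m ⟩
    d + p                ∎
    where
    open ≡-Reasoning
    d m p : ℕ
    d = downCount s
    m = matchedChildSum s
    p = atParent F π β s

  downCount-matchedDown : ∀ {r} → InR F r → π (φ r) ≡ just r → downCount (φ r) ≡ βbar (φ r)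
  downCount-matchedDown {r} r∈R r↓ =
    sym (trans (βbar-split (φ-S r∈R))
               (trans (cong (downCount (φ r) +_) (matchedChildSum-none unmatched)) (+-identityʳ _)))
    where
    unmatched : ∀ c → π c ≡ just (φ r) → φ c ≢ φ r
    unmatched c c→φr φc≡φr with φ-injective (child-of-S (φ-S r∈R) c→φr) r∈R φc≡φr
    ... | refl = parent-asym c→φr r↓

  βbar-matchedDown : ∀ {r} → InR F r → π (φ r) ≡ just r → βbar (φ r) ≡ βbar r
  βbar-matchedDown r∈R r↓ =
    ≤-antisym (subst (_≤ βbar _) (β-matchedDown r∈R r↓) (β≤βbar r∈R)) (βbar-R≤child r∈R r↓)

  -- Q a v holds when v is reached from a by climbing through parents matched upwards (up),
  -- then at most one step across to a sibling matched to the common parent (across), and then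
  -- descending through children matched downwards (Down); for a ∈ S this is exactly Reach a.
  data Down (s : Fin n) : Fin n → Set where
    here : Down s s
    down : ∀ {r v} → π r ≡ just s → π (φ r) ≡ just r → Down (φ r) v → Down s v

  data Above (a : Fin n) : Fin n → Set where
    across : ∀ {r v} → π a ≡ just r → π (φ r) ≡ just r → φ r ≢ a → Down (φ r) v → Above a v
    up     : ∀ {r v} → π a ≡ just r → π r ≡ just (φ r) → Down (φ r) v ⊎ Above (φ r) v → Above a v

  Q : Fin n → Fin n → Set
  Q a v = Down a v ⊎ Above a v

  -- A non-matching edge s r followed by the matching edge r φ(r): two steps of an alternating path.
  data Move (s : Fin n) : Fin n → Set where
    move : ∀ {r} → GEdge F s r → InR F r → φ r ≢ s → Move s (φ r)

  Reach : Fin n → Fin n → Set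
  Reach = Star Move

  Down-≼ : ∀ {s v} → Down s v → s ≼ v
  Down-≼ here              = ≼-refl
  Down-≼ (down r→s φr→r d) = ≼-parent (≼-parent (Down-≼ d) φr→r) r→s

  Down-snoc : ∀ {a s r} → Down a s → π r ≡ just s → π (φ r) ≡ just r → Down a (φ r)
  Down-snoc here              r→s r↓ = down r→s r↓ here
  Down-snoc (down r→a φr→r d) r→s r↓ = down r→a φr→r (Down-snoc d r→s r↓)

  Down-last : ∀ {a s} → Down a s → s ≡ a ⊎ ∃ λ p → π s ≡ just p × φ p ≡ s
  Down-last here                       = inj₁ refl
  Down-last (down {r} _ φr→r d) with Down-last d
  ... | inj₁ refl = inj₂ (r , φr→r , refl)
  ... | inj₂ last = inj₂ last

  Down-step : ∀ {a s t} → Down a s → Move s t → Q a t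
  Down-step d (move sr r∈R φr≢s) with edge-parent sr | φ-side r∈R
  ... | inj₂ r→s | inj₁ r↓ = inj₁ (Down-snoc d r→s r↓)
  ... | inj₂ r→s | inj₂ r↑ = ⊥-elim (φr≢s (parent-unique r↑ r→s))
  ... | inj₁ s→r | side with Down-last d
  ...   | inj₂ (p , s→p , φp≡s) = ⊥-elim (φr≢s (trans (cong φ (parent-unique s→r s→p)) φp≡s))
  ...   | inj₁ refl with side
  ...     | inj₁ r↓ = inj₂ (across s→r r↓ φr≢s here)
  ...     | inj₂ r↑ = inj₂ (up s→r r↑ (inj₁ here))

  Above-matchedDown-empty : ∀ {r t} → π (φ r) ≡ just r → ¬ Above (φ r) t
  Above-matchedDown-empty φr→r (across φr→p _ φp≢φr _) with parent-unique φr→r φr→p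
  ... | refl = φp≢φr refl
  Above-matchedDown-empty φr→r (up φr→p p↑ _) with parent-unique φr→r φr→p
  ... | refl = parent-asym φr→r p↑

  mutual
    Q-step : ∀ {a s t} → Q a s → Move s t → Q a t
    Q-step (inj₁ d)  m = Down-step d m
    Q-step (inj₂ ab) m = inj₂ (Above-step ab m)

    Above-step : ∀ {a s t} → Above a s → Move s t → Above a t
    Above-step (across a→r r↓ φr≢a d) m with Down-step d m
    ... | inj₁ d′ = across a→r r↓ φr≢a d′
    ... | inj₂ ab = ⊥-elim (Above-matchedDown-empty r↓ ab)
    Above-step (up a→r r↑ q) m = up a→r r↑ (Q-step q m)

  Reach→Q : ∀ {a v} → Reach a v → Q a v
  Reach→Q = Q-extend (inj₁ here)
    where
    Q-extend : ∀ {a s v} → Q a s → Reach s v → Q a v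
    Q-extend q ε        = q
    Q-extend q (m ◅ ms) = Q-extend (Q-step q m) ms

  Down→Reach : ∀ {s v} → InS F s → Down s v → Reach s v
  Down→Reach s∈S here = ε
  Down→Reach s∈S (down {r} r→s r↓ d) =
    move (GEdge-sym (parent-edge r→s)) r∈R (λ φr≡s → parent-asym r→s (trans (cong π (sym φr≡s)) r↓))
      ◅ Down→Reach (φ-S r∈R) d
    where
    r∈R : InR F r
    r∈R = child-of-S s∈S r→s

  mutual
    Q→Reach : ∀ {a v} → InS F a → Q a v → Reach a v
    Q→Reach a∈S (inj₁ d)  = Down→Reach a∈S d
    Q→Reach a∈S (inj₂ ab) = Above→Reach a∈S ab

    Above→Reach : ∀ {a v} → InS F a → Above a v → Reach a v
    Above→Reach a∈S (across {r} a→r _ φr≢a d) =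
      move (parent-edge a→r) r∈R φr≢a ◅ Down→Reach (φ-S r∈R) d
      where
      r∈R : InR F r
      r∈R = parent-of-S a∈S a→r
    Above→Reach a∈S (up {r} a→r r↑ q) =
      move (parent-edge a→r) r∈R (λ φr≡a → parent-asym a→r (trans r↑ (cong just φr≡a)))
        ◅ Q→Reach (φ-S r∈R) q
      where
      r∈R : InR F r
      r∈R = parent-of-S a∈S a→r

  InM-φ : ∀ {r} → InR F r → InM F φ r (φ r)
  InM-φ r∈R = _ , r∈R , inj₁ (refl , refl)

  InM-φ˘ : ∀ {r} → InR F r → InM F φ (φ r) r
  InM-φ˘ r∈R = _ , r∈R , inj₂ (refl , refl)

  InM-from-R : ∀ {r t} → InR F r → InM F φ r t → t ≡ φ r
  InM-from-R _         (_ , _ , inj₁ (refl , t≡φr)) = t≡φr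
  InM-from-R (_ , r∉S) (_ , q∈R , inj₂ (refl , refl)) = ⊥-elim (r∉S (φ-S q∈R))

  InM-from-S : ∀ {s r} → InS F s → InM F φ s r → φ r ≡ s
  InM-from-S s∈S (_ , (_ , s∉S) , inj₁ (refl , _)) = ⊥-elim (s∉S s∈S)
  InM-from-S _   (_ , _ , inj₂ (s≡φr , refl))      = sym s≡φr

  unsaturated⇒S : ∀ {u} → Unsaturated F φ u → InS F u
  unsaturated⇒S (u∈G , unsat) with VG-S⊎R u∈G
  ... | inj₁ u∈S = u∈S
  ... | inj₂ u∈R = ⊥-elim (unsat _ (InM-φ u∈R))

  unsaturated-φ : ∀ {u r} → Unsaturated F φ u → InR F r → φ r ≢ u
  unsaturated-φ (_ , unsat) r∈R refl = unsat _ (InM-φ˘ r∈R)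

  UnmatchedStart : Fin n → List (Fin n) → Set
  UnmatchedStart s []      = ⊤
  UnmatchedStart s (r ∷ _) = ¬ InM F φ s r

  Alternating-tail : ∀ {x xs} → Alternating F φ (x ∷ xs) → Alternating F φ xs
  Alternating-tail {xs = []}        _         = tt
  Alternating-tail {xs = _ ∷ []}    _         = tt
  Alternating-tail {xs = _ ∷ _ ∷ _} (_ , alt) = alt

  matched-then-unmatched : ∀ {r t} ws → InM F φ r t → Alternating F φ (r ∷ t ∷ ws) → UnmatchedStart t ws
  matched-then-unmatched []      _    _                     = tt
  matched-then-unmatched (_ ∷ _) _    (inj₁ (_ , ¬tx) , _)  = ¬tx
  matched-then-unmatched (_ ∷ _) r-t∈M (inj₂ (r-t∉M , _) , _) = ⊥-elim (r-t∉M r-t∈M)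

  unmatched-then-matched : ∀ {s r t} → ¬ InM F φ s r →
                           (InM F φ s r × ¬ InM F φ r t) ⊎ (¬ InM F φ s r × InM F φ r t) → InM F φ r t
  unmatched-then-matched s-r∉M (inj₁ (s-r∈M , _)) = ⊥-elim (s-r∉M s-r∈M)
  unmatched-then-matched _     (inj₂ (_ , r-t∈M)) = r-t∈M

  alternatingWalk⇒Reach : ∀ {s v} ws → InS F s → Linked (GEdge F) (s ∷ ws) → Alternating F φ (s ∷ ws) →
                          UnmatchedStart s ws → 2 ∣ length ws → last (s ∷ ws) ≡ just v → Reach s v
  alternatingWalk⇒Reach []           _   _ _ _ _   refl = ε
  alternatingWalk⇒Reach (_ ∷ [])     _   _ _ _ 2∣1 _    with () ← ∣1⇒≡1 2∣1
  alternatingWalk⇒Reach (r ∷ t ∷ ws) s∈S (sr ∷ rt ∷ walk) (first , alt) s-r∉M 2∣ last≡v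
    with r-t∈M ← unmatched-then-matched s-r∉M first
    with refl ← InM-from-R (S-neighbour-R s∈S sr) r-t∈M =
    move sr r∈R (λ φr≡s → s-r∉M (subst (λ x → InM F φ x r) φr≡s (InM-φ˘ r∈R)))
      ◅ alternatingWalk⇒Reach ws (φ-S r∈R) walk (Alternating-tail alt) (matched-then-unmatched ws r-t∈M alt)
                              (∣m+n∣m⇒∣n 2∣ ∣-refl) last≡v
    where
    r∈R : InR F r
    r∈R = S-neighbour-R s∈S sr

  walk : ∀ {s v} → Reach s v → List (Fin n)
  walk ε                      = []
  walk (move {r} _ _ _ ◅ ms) = r ∷ φ r ∷ walk ms

  move-unmatched : ∀ {s r} → GEdge F s r → InR F r → φ r ≢ s → ¬ InM F φ s r
  move-unmatched sr r∈R φr≢s = φr≢s ∘ InM-from-S (R-neighbour-S r∈R (GEdge-sym sr))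

  walk-unmatchedStart : ∀ {s v} (ms : Reach s v) → UnmatchedStart s (walk ms)
  walk-unmatchedStart ε                         = tt
  walk-unmatchedStart (move sr r∈R φr≢s ◅ _) = move-unmatched sr r∈R φr≢s

  walk-linked : ∀ {s v} (ms : Reach s v) → Linked (GEdge F) (s ∷ walk ms)
  walk-linked ε                       = [-]
  walk-linked (move sr r∈R _ ◅ ms) = sr ∷ proj₁ (matching _ r∈R) ∷ walk-linked ms

  Alternating-∷ : ∀ {r} ws → InR F r → UnmatchedStart (φ r) ws → Alternating F φ (φ r ∷ ws) →
                  Alternating F φ (r ∷ φ r ∷ ws)
  Alternating-∷ []      _   _      _   = tt
  Alternating-∷ (_ ∷ _) r∈R φr-x∉M alt = inj₁ (InM-φ r∈R , φr-x∉M) , alt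

  NonBacktracking-∷ : ∀ {r} ws → InR F r → UnmatchedStart (φ r) ws → NonBacktracking (φ r ∷ ws) →
                      NonBacktracking (r ∷ φ r ∷ ws)
  NonBacktracking-∷ []      _   _      _  = tt
  NonBacktracking-∷ (_ ∷ _) r∈R φr-x∉M nb = (λ r≡x → φr-x∉M (subst (InM F φ _) r≡x (InM-φ˘ r∈R))) , nb

  walk-alternating : ∀ {s v} (ms : Reach s v) → Alternating F φ (s ∷ walk ms)
  walk-alternating ε                        = tt
  walk-alternating (move sr r∈R φr≢s ◅ ms) =
    inj₂ (move-unmatched sr r∈R φr≢s , InM-φ r∈R) ,
    Alternating-∷ (walk ms) r∈R (walk-unmatchedStart ms) (walk-alternating ms)

  walk-nonBacktracking : ∀ {s v} (ms : Reach s v) → NonBacktracking (s ∷ walk ms)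
  walk-nonBacktracking ε                      = tt
  walk-nonBacktracking (move _ r∈R φr≢s ◅ ms) =
    φr≢s ∘ sym , NonBacktracking-∷ (walk ms) r∈R (walk-unmatchedStart ms) (walk-nonBacktracking ms)

  walk-even : ∀ {s v} (ms : Reach s v) → 2 ∣ length (walk ms)
  walk-even ε        = 2 ∣0
  walk-even (move _ _ _ ◅ ms) = ∣m∣n⇒∣m+n ∣-refl (walk-even ms)

  walk-last : ∀ {s v} (ms : Reach s v) → last (s ∷ walk ms) ≡ just v
  walk-last ε        = refl
  walk-last (move _ _ _ ◅ ms) = walk-last ms

  Reach⇒InQ : ∀ {s v} → Reach s v → InQ F φ s v
  Reach⇒InQ ms =
    walk ms , nonBacktracking⇒Unique (Linked.map proj₁ (walk-linked ms)) (walk-nonBacktracking ms) ,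
    walk-linked ms , walk-alternating ms , walk-even ms , walk-last ms
    where open Forest forest

  InQ⇒Reach : ∀ {u v} → Unsaturated F φ u → InQ F φ u v → Reach u v
  InQ⇒Reach {u} unsat (ws , _ , linked , alt , even , last≡v) =
    alternatingWalk⇒Reach ws (unsaturated⇒S unsat) linked alt (start ws) even last≡v
    where
    start : ∀ ws → UnmatchedStart u ws
    start []      = tt
    start (w ∷ _) = proj₂ unsat w

  Q-avoids-matched-child : ∀ {a r v} → π r ≡ just a → φ r ≡ a → Q a v → ¬ r ≼ v
  Q-avoids-matched-child r→a φr≡a (inj₁ here) r≼a = <⇒≱ (depth-parent r→a) (≼-depth r≼a)
  Q-avoids-matched-child r→a φr≡a (inj₁ (down c→a φc→c d)) r≼v
    with refl ← ≼-sibling r→a c→a r≼v (≼-parent (Down-≼ d) φc→c) =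
    parent-asym r→a (trans (cong π (sym φr≡a)) φc→c)
  Q-avoids-matched-child r→a _ (inj₂ (across a→p φp→p φp≢a d)) r≼v =
    φp≢a (≼-sibling φp→p a→p (Down-≼ d) (≼-parent r≼v r→a))
  Q-avoids-matched-child r→a _ (inj₂ (up a→p p↑ q)) r≼v =
    Q-avoids-matched-child p↑ refl q (≼-parent (≼-parent r≼v r→a) a→p)

  Down-Above-disjoint : ∀ {a v} → Down a v → Above a v → ⊥
  Down-Above-disjoint d (across a→r φr→r φr≢a d′) = φr≢a (≼-sibling φr→r a→r (Down-≼ d′) (Down-≼ d))
  Down-Above-disjoint d (up a→r r↑ q)            = Q-avoids-matched-child r↑ refl q (≼-parent (Down-≼ d) a→r)

  Down-card : ∀ {s} → Acc Deeper s → InS F s → HasCard (Down s) (downCount s)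
  Down-card {s} (acc deeper) s∈S =
    HasCard-cong Down⇔ (HasCard-⊎ root∉branches (HasCard-≡ s) (HasCard-∃ branch-unique branch-card))
    where
    Branch : Fin n → Fin n → Set
    Branch r v = π r ≡ just s × π (φ r) ≡ just r × Down (φ r) v

    Down⇔ : ∀ v → (v ≡ s ⊎ ∃ λ r → Branch r v) ⇔ Down s v
    Down⇔ v = mk⇔ (λ { (inj₁ refl) → here ; (inj₂ (_ , r→s , r↓ , d)) → down r→s r↓ d })
                  (λ { here → inj₁ refl ; (down r→s r↓ d) → inj₂ (_ , r→s , r↓ , d) })

    root∉branches : ∀ {v} → v ≡ s → ∃ (λ r → Branch r v) → ⊥
    root∉branches refl (_ , r→s , r↓ , d) =
      <⇒≱ (<-trans (depth-parent r→s) (depth-parent r↓)) (≼-depth (Down-≼ d))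

    branch-unique : ∀ {r r′ v} → Branch r v → Branch r′ v → r ≡ r′
    branch-unique (r→s , r↓ , d) (r′→s , r′↓ , d′) =
      ≼-sibling r→s r′→s (≼-parent (Down-≼ d) r↓) (≼-parent (Down-≼ d′) r′↓)

    branch-card : ∀ r → HasCard (Branch r)
      (if does (child? s r) then (if does (φ r ≟ s) then 0 else βbar r) else 0)
    branch-card r with child? s r | φ r ≟ s
    ... | no ¬r→s | _ = HasCard-∅ (λ v (r→s , _) → ¬r→s r→s)
    ... | yes r→s | yes φr≡s =
      HasCard-∅ (λ v (_ , r↓ , _) → parent-asym r→s (trans (cong π (sym φr≡s)) r↓))
    ... | yes r→s | no φr≢s with φ-side (child-of-S s∈S r→s)
    ...   | inj₂ r↑ = ⊥-elim (φr≢s (parent-unique r↑ r→s))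
    ...   | inj₁ r↓ =
      HasCard-cong (λ v → mk⇔ (λ d → r→s , r↓ , d) (λ (_ , _ , d) → d))
        (subst (HasCard (Down (φ r)))
               (trans (downCount-matchedDown r∈R r↓) (βbar-matchedDown r∈R r↓))
               (Down-card (deeper (<-trans (depth-parent r→s) (depth-parent r↓))) (φ-S r∈R)))
      where
      r∈R : InR F r
      r∈R = child-of-S s∈S r→s

  Q-card : ∀ {a k} → InS F a → HasCard (Above a) k → HasCard (Q a) (downCount a + k)
  Q-card a∈S = HasCard-⊎ Down-Above-disjoint (Down-card (deeper-wellFounded _) a∈S)

  ParentUnmatched : Fin n → Set
  ParentUnmatched a = ∀ r → π a ≡ just r → φ r ≢ a

  Above⇔Down : ∀ {a r v} → π a ≡ just r → π (φ r) ≡ just r → φ r ≢ a → Above a v ⇔ Down (φ r) v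
  Above⇔Down {a} {r} {v} a→r r↓ φr≢a = mk⇔ Above→Down (across a→r r↓ φr≢a)
    where
    Above→Down : Above a v → Down (φ r) v
    Above→Down (across a→p _ _ d) with refl ← parent-unique a→r a→p = d
    Above→Down (up a→p p↑ _)      with refl ← parent-unique a→r a→p = ⊥-elim (parent-asym p↑ r↓)

  Above⇔Q : ∀ {a r v} → π a ≡ just r → π r ≡ just (φ r) → Above a v ⇔ Q (φ r) v
  Above⇔Q {a} {r} {v} a→r r↑ = mk⇔ Above→Q (up a→r r↑)
    where
    Above→Q : Above a v → Q (φ r) v
    Above→Q (across a→p p↓ _ _) with refl ← parent-unique a→r a→p = ⊥-elim (parent-asym r↑ p↓)
    Above→Q (up a→p _ q)        with refl ← parent-unique a→r a→p = q

  Above-card : ∀ {a} → Acc Shallower a → InS F a → ParentUnmatched a → HasCard (Above a) (atParent F π β a)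
  Above-card {a} (acc shallower) a∈S a-unmatched with π a in a→?
  ... | nothing = HasCard-∅ λ where
      v (across a→r _ _ _) → nothing≢just (trans (sym a→?) a→r)
      v (up a→r _ _)       → nothing≢just (trans (sym a→?) a→r)
    where
    nothing≢just : ∀ {r} → nothing ≢ just r
    nothing≢just ()
  ... | just r with φ-side (parent-of-S a∈S a→?)
  ...   | inj₁ r↓ =
    -- the with-abstraction has turned the type of a-unmatched into ∀ r′ → just r ≡ just r′ → …
    HasCard-cong (λ v → ⇔-sym (Above⇔Down a→? r↓ (a-unmatched r refl)))
      (subst (HasCard (Down (φ r)))
             (trans (downCount-matchedDown r∈R r↓) (sym (β-matchedDown r∈R r↓)))
             (Down-card (deeper-wellFounded _) (φ-S r∈R)))
    where
    r∈R : InR F r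
    r∈R = parent-of-S a∈S a→?
  ...   | inj₂ r↑ =
    HasCard-cong (λ v → ⇔-sym (Above⇔Q a→? r↑))
      (subst (HasCard (Q (φ r))) count
             (Q-card (φ-S r∈R) (Above-card (shallower (<-trans (depth-parent r↑) (depth-parent a→?)))
                                           (φ-S r∈R) φr-unmatched)))
    where
    open ≡-Reasoning
    r∈R : InR F r
    r∈R = parent-of-S a∈S a→?
    φr-unmatched : ParentUnmatched (φ r)
    φr-unmatched r′ φr→r′ φr′≡φr with refl ← φ-injective (parent-of-S (φ-S r∈R) φr→r′) r∈R φr′≡φr =
      parent-asym φr→r′ r↑
    count : downCount (φ r) + atParent F π β (φ r) ≡ β r
    count = begin
      downCount (φ r) + atParent F π β (φ r) ≡⟨ β-minus-matched (φ-S r∈R) ⟨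
      β (φ r) ∸ matchedChildSum (φ r)        ≡⟨ cong (β (φ r) ∸_) (matchedChildSum-single r∈R r↑ refl) ⟩
      β (φ r) ∸ βbar r                       ≡⟨ β-matchedUp r∈R r↑ ⟨
      β r                                    ∎

lemma14 : ∀ {n} (F : Graph n) → IsForest F
    → (π : Fin n → Maybe (Fin n)) → IsRooting F π
    → (βbar β : Fin n → ℕ) → IsBetaBar F π βbar → IsBeta F π βbar β
    → (φ : Fin n → Fin n) → IsBetaMatching F π βbar β φ
    → (u : Fin n) → Unsaturated F φ u
    → HasCard (InQ F φ u) (β u)
lemma14 F forest π rooting βbar β isβbar isβ φ matching u unsat =
  HasCard-cong Q⇔InQ
    (subst (HasCard (Q u)) count (Q-card u∈S (Above-card (shallower-wellFounded u) u∈S u-unmatched)))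
  where
  open Rooting rooting
  open BetaMatching forest rooting βbar β isβbar isβ φ matching
  u∈S : InS F u
  u∈S = unsaturated⇒S unsat
  Q⇔InQ : ∀ v → Q u v ⇔ InQ F φ u v
  Q⇔InQ v = mk⇔ (Reach⇒InQ ∘ Q→Reach u∈S) (Reach→Q ∘ InQ⇒Reach unsat)
  u-unmatched : ParentUnmatched u
  u-unmatched r u→r = unsaturated-φ unsat (parent-of-S u∈S u→r)
  count : downCount u + atParent F π β u ≡ β u
  count = trans (sym (β-minus-matched u∈S))
                (cong (β u ∸_) (matchedChildSum-none (λ c c→u → unsaturated-φ unsat (child-of-S u∈S c→u))))
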